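{- Let $S_c[X]$ be the direct limit described in the context and let $\eta:X\cup X^c\to S_c[X]$ be given by $x_i\mapsto\overline{(x_i,i)}$, $x_i^c\mapsto\overline{(x_i^c,i)}$. Then $S_c[X]$ is the free I-C semiring generated by $X$: namely, $S_c[X]$ is an I-C semiring, $\eta$ is injective, and for every I-C semiring $T$ and every map $f:X\cup X^c\to T$ with $f(x_i)\cdot f(x_i^c)=\theta$ and $f(x_i)\circ f(x_i^c)=1$ for all $i$, there is a unique semiring homomorphism $\bar f:S_c[X]\to T$ with $\bar f\circ\eta=f$.
   Context: A semiring is a set $S$ with operations $\circ$ and $\cdot$ such that $(S,\circ)$ is a commutative monoid with identity $\theta$, $(S,\cdot)$ is a monoid with identity $1$, $\cdot$ distributes over $\circ$ on both sides, $\theta\cdot s=s\cdot\theta=\theta$ for all $s$, and $1\neq\theta$. A commutative semiring $S$ is an idempotent complement (I-C) semiring if for every $s\in S$ there is $t\in S$ (denoted $s^c$) with $s\cdot t=\theta$, $s\circ t=1$, $s\cdot s=s$, $s\circ s=s$. Let $X=\{x_1,x_2,\dots\}$ be countable, $X^c=\{x_1^c,x_2^c,\dots\}$, and for $N\ge1$ let $X_N=\{x_1,\dots,x_N\}$, $X_N^c=\{x_1^c,\dots,x_N^c\}$. Let $S_c[X_N]$ be the quotient of the free commutative semiring on $X_N\cup X_N^c$ by the congruence generated by $(x_i\cdot x_i^c,\theta)$, $(x_i\circ x_i^c,1)$, $(x_i\circ x_i,x_i)$, $(x_i^c\circ x_i^c,x_i^c)$, $1\le i\le N$. For $N\le M$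 let $f_{NM}:S_c[X_N]\to S_c[X_M]$ be the semiring homomorphism induced by $x_i\mapsto x_i$, $x_i^c\mapsto x_i^c$. Let $S_c[X]$ be the direct limit: on $\bigsqcup_{N\ge1}S_c[X_N]\times\{N\}$ put $(a,i)\sim(b,j)$ iff $f_{ik}(a)=f_{jk}(b)$ for some $k\ge i,j$; write $\overline{(a,i)}$ for the class, and define $\overline{(a,i)}\diamond\overline{(b,j)}=\overline{(f_{ik}(a)\diamond f_{jk}(b),k)}$ for $\diamond\in\{\circ,\cdot\}$ and some $k\ge i,j$. Semiring homomorphisms preserve $\circ,\cdot,\theta,1$. -}

module Defs where

open import Level using (Level) renaming (suc to lsuc; _⊔_ to _⊔ˡ_)
open import Data.Nat using (ℕ; suc; _≤_; s≤s) renaming (_⊔_ to max)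
open import Data.Nat.Properties using (m≤m⊔n; m≤n⊔m)
open import Data.Fin using (Fin; inject≤; fromℕ)
open import Data.Sum using (_⊎_; inj₁; inj₂)
open import Data.Product using (Σ; ∃; _×_; _,_)
open import Relation.Nullary using (¬_)
open import Algebra.Structures using (IsCommutativeSemiring)
open import Algebra.Bundles using (CommutativeSemiring)
open import Algebra.Bundles.Raw using (RawSemiring)

-- I-C semirings.  Notation: ∘ is written _+_ (identity 0# = θ),
-- · is written _*_ (identity 1#).  Equality is a setoid equality _≈_.

record IsICSemiring {c ℓ} {A : Set c} (_≈_ : A → A → Set ℓ)
         (_+_ _*_ : A → A → A) (0# 1# : A) : Set (c ⊔ˡ ℓ) where
  field
    isCommutativeSemiring : IsCommutativeSemiring _≈_ _+_ _*_ 0# 1#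
    1≉0 : ¬ (1# ≈ 0#)
    complement : ∀ s → ∃ λ t → ((s * t) ≈ 0#) × ((s + t) ≈ 1#)
                               × ((s * s) ≈ s) × ((s + s) ≈ s)

record ICSemiring c ℓ : Set (lsuc (c ⊔ˡ ℓ)) where
  field
    commutativeSemiring : CommutativeSemiring c ℓ
  open CommutativeSemiring commutativeSemiring public
  field
    1≉0 : ¬ (1# ≈ 0#)
    complement : ∀ s → ∃ λ t → ((s * t) ≈ 0#) × ((s + t) ≈ 1#)
                               × ((s * s) ≈ s) × ((s + s) ≈ s)

data Term (G : Set) : Set where
  gen  : G → Term G
  θ    : Term G
  one  : Term G
  _∘_  : Term G → Term G → Term G
  _·_  : Term G → Term G → Term G

infixl 6 _∘_
infixl 7 _·_

rename : ∀ {G H : Set} → (G → H) → Term G → Term H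
rename f (gen g) = gen (f g)
rename f θ       = θ
rename f one     = one
rename f (s ∘ t) = rename f s ∘ rename f t
rename f (s · t) = rename f s · rename f t

-- Generators of X_N ∪ X_N^c:  inj₁ i = x_{i+1},  inj₂ i = x_{i+1}^c.
Gen : ℕ → Set
Gen N = Fin N ⊎ Fin N

-- Term (Gen N) / _≈[ N ]_  is  S_c[X_N].
data _≈[_]_ : ∀ {N} → Term (Gen N) → (M : ℕ) → Term (Gen N) → Set where
  ≈refl   : ∀ {N} {s : Term (Gen N)} → s ≈[ N ] s
  ≈sym    : ∀ {N} {s t : Term (Gen N)} → s ≈[ N ] t → t ≈[ N ] s
  ≈trans  : ∀ {N} {s t u : Term (Gen N)} → s ≈[ N ] t → t ≈[ N ] u → s ≈[ N ] u
  ∘-cong  : ∀ {N} {s s' t t' : Term (Gen N)} → s ≈[ N ] s' → t ≈[ N ] t' → (s ∘ t) ≈[ N ] (s' ∘ t')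
  ·-cong  : ∀ {N} {s s' t t' : Term (Gen N)} → s ≈[ N ] s' → t ≈[ N ] t' → (s · t) ≈[ N ] (s' · t')
  ∘-assoc : ∀ {N} (s t u : Term (Gen N)) → ((s ∘ t) ∘ u) ≈[ N ] (s ∘ (t ∘ u))
  ∘-comm  : ∀ {N} (s t : Term (Gen N)) → (s ∘ t) ≈[ N ] (t ∘ s)
  ∘-idˡ   : ∀ {N} (s : Term (Gen N)) → (θ ∘ s) ≈[ N ] s
  ∘-idʳ   : ∀ {N} (s : Term (Gen N)) → (s ∘ θ) ≈[ N ] s
  ·-assoc : ∀ {N} (s t u : Term (Gen N)) → ((s · t) · u) ≈[ N ] (s · (t · u))
  ·-comm  : ∀ {N} (s t : Term (Gen N)) → (s · t) ≈[ N ] (t · s)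
  ·-idˡ   : ∀ {N} (s : Term (Gen N)) → (one · s) ≈[ N ] s
  ·-idʳ   : ∀ {N} (s : Term (Gen N)) → (s · one) ≈[ N ] s
  distribˡ : ∀ {N} (s t u : Term (Gen N)) → (s · (t ∘ u)) ≈[ N ] ((s · t) ∘ (s · u))
  distribʳ : ∀ {N} (s t u : Term (Gen N)) → ((t ∘ u) · s) ≈[ N ] ((t · s) ∘ (u · s))
  zeroˡ   : ∀ {N} (s : Term (Gen N)) → (θ · s) ≈[ N ] θ
  zeroʳ   : ∀ {N} (s : Term (Gen N)) → (s · θ) ≈[ N ] θ
  compl-· : ∀ {N} (i : Fin N) → (gen (inj₁ i) · gen (inj₂ i)) ≈[ N ] θ
  compl-∘ : ∀ {N} (i : Fin N) → (gen (inj₁ i) ∘ gen (inj₂ i)) ≈[ N ] one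
  idem-x  : ∀ {N} (i : Fin N) → (gen (inj₁ i) ∘ gen (inj₁ i)) ≈[ N ] gen (inj₁ i)
  idem-xc : ∀ {N} (i : Fin N) → (gen (inj₂ i) ∘ gen (inj₂ i)) ≈[ N ] gen (inj₂ i)

f[_,_] : ∀ {N M} → N ≤ M → Term (Gen N) → Term (Gen M)
f[_,_] N≤M = rename λ { (inj₁ i) → inj₁ (inject≤ i N≤M) ; (inj₂ i) → inj₂ (inject≤ i N≤M) }

-- The direct limit S_c[X].  An element (n , a) stands for (a, N) with
-- N = n+1 ≥ 1 and a a representative of an element of S_c[X_N].

ScX : Set
ScX = Σ ℕ λ n → Term (Gen (suc n))

_~_ : ScX → ScX → Set
(i , a) ~ (j , b) = ∃ λ k → Σ (suc i ≤ k) λ p → Σ (suc j ≤ k) λ q →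
                      f[_,_] p a ≈[ k ] f[_,_] q b

private
  up₁ : ∀ i j → suc i ≤ suc (max i j)
  up₁ i j = s≤s (m≤m⊔n i j)
  up₂ : ∀ i j → suc j ≤ suc (max i j)
  up₂ i j = s≤s (m≤n⊔m i j)

_∘L_ : ScX → ScX → ScX
(i , a) ∘L (j , b) = max i j , (f[_,_] (up₁ i j) a ∘ f[_,_] (up₂ i j) b)

_·L_ : ScX → ScX → ScX
(i , a) ·L (j , b) = max i j , (f[_,_] (up₁ i j) a · f[_,_] (up₂ i j) b)

θL : ScX
θL = 0 , θ

1L : ScX
1L = 0 , one

ScX-raw : RawSemiring Level.zero Level.zero
ScX-raw = record { Carrier = ScX ; _≈_ = _~_ ; _+_ = _∘L_ ; _*_ = _·L_ ; 0# = θL ; 1# = 1L }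

-- X ∪ X^c :  inj₁ i = x_{i+1},  inj₂ i = x_{i+1}^c.
XXc : Set
XXc = ℕ ⊎ ℕ

-- η(x_N) = (x_N , N),  η(x_N^c) = (x_N^c , N).
η : XXc → ScX
η (inj₁ i) = i , gen (inj₁ (fromℕ i))
η (inj₂ i) = i , gen (inj₂ (fromℕ i))

module Submission where

open import Level using (Level; 0ℓ)
open import Data.Nat using (ℕ; zero; suc; _≤_; s≤s; z≤n; _≡ᵇ_) renaming (_⊔_ to max)
open import Data.Nat.Properties
  using (≤-refl; ≤-trans; m≤m⊔n; m≤n⊔m; ⊔-mono-≤; ≡ᵇ⇒≡; ≡⇒≡ᵇ)
open import Data.Fin using (Fin; zero; suc; toℕ; fromℕ; inject≤)
open import Data.Fin.Properties
  using (toℕ-injective; toℕ-inject≤; toℕ-fromℕ; toℕ<n; inject≤-idempotent)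
open import Data.Vec.Functional using ([]; _∷_)
open import Data.Product using (Σ; ∃; ∃₂; _×_; _,_; proj₁; proj₂; zip)
open import Data.Sum using (inj₁; inj₂) renaming (map to ⊎-map)
open import Data.Bool using (Bool; true; false; not; T)
open import Data.Bool.Properties
  using (∨-∧-commutativeSemiring; ∧-inverseʳ; ∨-inverseʳ; ∧-idem; ∨-idem; not-injective)
open import Relation.Binary.PropositionalEquality as ≡ using (_≡_; cong; cong₂)
open import Relation.Binary.Structures using (IsEquivalence)
open import Relation.Nullary using (¬_)
open import Algebra.Bundles using (CommutativeSemiring)
open import Algebra.Bundles.Raw using (RawSemiring)
open import Algebra.Structures.Biased using (isCommutativeSemiringˡ; isCommutativeMonoidˡ)
open import Algebra.Morphism.Structures using (module SemiringMorphisms)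
open SemiringMorphisms using (IsSemiringHomomorphism)
import Algebra.Morphism.Construct.Composition as Composition

open import Defs
  renaming (distribˡ to ·-distribˡ-∘; distribʳ to ·-distribʳ-∘; zeroˡ to ·-zeroˡ; zeroʳ to ·-zeroʳ)

-- The relations make every generator complemented and force 1 ∘ 1 = 1 (as 1 = x ∘ xᶜ with
-- x, xᶜ ∘-idempotent). In a commutative semiring with 1 ∘ 1 = 1, complemented elements are
-- idempotent and, by De Morgan, closed under ∘ and ·, so every element of S_c[X_N] has a
-- complement. Finitely many elements of S_c[X] are represented at a common level; hence the
-- identities valid in every S_c[X_N] hold in S_c[X], and complements pass along the maps
-- S_c[X_N] → S_c[X]. The extension of f evaluates a representative in T: this is well defined
-- because evaluation is invariant under f_NM and respects the relations, and it is forced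
-- because every element is the image of a term. Boolean valuations separate the generators
-- and separate 1 from θ.

module Complements {c ℓ} (R : CommutativeSemiring c ℓ) where
  open CommutativeSemiring R
  open import Algebra.Properties.CommutativeSemigroup +-commutativeSemigroup using (interchange)
  open import Algebra.Solver.Ring.NaturalCoefficients.Default R using (solve; _:=_; _:+_; _:*_)
  open import Relation.Binary.Reasoning.Setoid setoid

  Complement : Carrier → Carrier → Set ℓ
  Complement a a' = (a * a' ≈ 0#) × (a + a' ≈ 1#)

  complement-comm : ∀ {a a'} → Complement a a' → Complement a' a
  complement-comm (aa'≈0 , a+a'≈1) = trans (*-comm _ _) aa'≈0 , trans (+-comm _ _) a+a'≈1

  complement-0#-1# : Complement 0# 1#
  complement-0#-1# = zeroˡ 1# , +-identityˡ 1#

  complement⇒*-idem : ∀ {a a'} → Complement a a' → a * a ≈ a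
  complement⇒*-idem {a} {a'} (aa'≈0 , a+a'≈1) = begin
    a * a             ≈⟨ +-identityʳ (a * a) ⟨
    a * a + 0#        ≈⟨ +-congˡ aa'≈0 ⟨
    a * a + a * a'    ≈⟨ distribˡ a a a' ⟨
    a * (a + a')      ≈⟨ *-congˡ a+a'≈1 ⟩
    a * 1#            ≈⟨ *-identityʳ a ⟩
    a                 ∎

  idempotent-complement⇒1+1≈1 : ∀ {a a'} → Complement a a' → a + a ≈ a → a' + a' ≈ a' →
                                1# + 1# ≈ 1#
  idempotent-complement⇒1+1≈1 {a} {a'} (_ , a+a'≈1) a+a≈a a'+a'≈a' = begin
    1# + 1#                  ≈⟨ +-cong a+a'≈1 a+a'≈1 ⟨
    (a + a') + (a + a')      ≈⟨ interchange a a' a a' ⟩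
    (a + a) + (a' + a')      ≈⟨ +-cong a+a≈a a'+a'≈a' ⟩
    a + a'                   ≈⟨ a+a'≈1 ⟩
    1#                       ∎

  module _ (1+1≈1 : 1# + 1# ≈ 1#) where

    +-idem : ∀ a → a + a ≈ a
    +-idem a = begin
      a + a                ≈⟨ +-cong (*-identityʳ a) (*-identityʳ a) ⟨
      a * 1# + a * 1#      ≈⟨ distribˡ a 1# 1# ⟨
      a * (1# + 1#)        ≈⟨ *-congˡ 1+1≈1 ⟩
      a * 1#               ≈⟨ *-identityʳ a ⟩
      a                    ∎

    +-complement : ∀ {a a' b b'} → Complement a a' → Complement b b' →
                   Complement (a + b) (a' * b')
    +-complement {a} {a'} {b} {b'} (aa'≈0 , a+a'≈1) (bb'≈0 , b+b'≈1) = product≈0 , sum≈1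
      where
      product≈0 : (a + b) * (a' * b') ≈ 0#
      product≈0 = begin
        (a + b) * (a' * b')            ≈⟨ solve 4 (λ a a' b b' →
                                            (a :+ b) :* (a' :* b') := (a :* a') :* b' :+ (b :* b') :* a')
                                          refl a a' b b' ⟩
        (a * a') * b' + (b * b') * a'  ≈⟨ +-cong (*-congʳ aa'≈0) (*-congʳ bb'≈0) ⟩
        0# * b' + 0# * a'              ≈⟨ +-cong (zeroˡ b') (zeroˡ a') ⟩
        0# + 0#                        ≈⟨ +-identityˡ 0# ⟩
        0#                             ∎
      sum≈1 : (a + b) + a' * b' ≈ 1#
      sum≈1 = begin
        (a + b) + a' * b'
          ≈⟨ +-congʳ (+-cong (trans (*-congˡ b+b'≈1) (*-identityʳ a))
                             (trans (*-congʳ a+a'≈1) (*-identityˡ b))) ⟨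
        (a * (b + b') + (a + a') * b) + a' * b'
          ≈⟨ solve 4 (λ a a' b b' → (a :* (b :+ b') :+ (a :+ a') :* b) :+ a' :* b'
                                   := (a :* b :+ a :* b) :+ (a :* b' :+ a' :* b :+ a' :* b'))
                     refl a a' b b' ⟩
        (a * b + a * b) + (a * b' + a' * b + a' * b')
          ≈⟨ +-congʳ (+-idem (a * b)) ⟩
        a * b + (a * b' + a' * b + a' * b')
          ≈⟨ solve 4 (λ a a' b b' → a :* b :+ (a :* b' :+ a' :* b :+ a' :* b')
                                   := (a :+ a') :* (b :+ b'))
                     refl a a' b b' ⟩
        (a + a') * (b + b')
          ≈⟨ *-cong a+a'≈1 b+b'≈1 ⟩
        1# * 1#
          ≈⟨ *-identityˡ 1# ⟩
        1#
          ∎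

    *-complement : ∀ {a a' b b'} → Complement a a' → Complement b b' →
                   Complement (a * b) (a' + b')
    *-complement ca cb = complement-comm (+-complement (complement-comm ca) (complement-comm cb))

    isICSemiring : ¬ (1# ≈ 0#) → (∀ a → ∃ (Complement a)) → IsICSemiring _≈_ _+_ _*_ 0# 1#
    isICSemiring 1≉0 complemented = record
      { isCommutativeSemiring = isCommutativeSemiring
      ; 1≉0 = 1≉0
      ; complement = λ a → let (a' , aa'≈0 , a+a'≈1) = complemented a in
          a' , aa'≈0 , a+a'≈1 , complement⇒*-idem (aa'≈0 , a+a'≈1) , +-idem a
      }

open Complements using (Complement)

complement-homo : ∀ {a ℓa b ℓb} {R : CommutativeSemiring a ℓa} {S : CommutativeSemiring b ℓb}
                  {h : CommutativeSemiring.Carrier R → CommutativeSemiring.Carrier S} →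
                  IsSemiringHomomorphism
                    (CommutativeSemiring.rawSemiring R) (CommutativeSemiring.rawSemiring S) h →
                  ∀ {x x'} → Complement R x x' → Complement S (h x) (h x')
complement-homo {S = S} h-hom (xx'≈0 , x+x'≈1) =
    trans (sym (*-homo _ _)) (trans (⟦⟧-cong xx'≈0) 0#-homo)
  , trans (sym (+-homo _ _)) (trans (⟦⟧-cong x+x'≈1) 1#-homo)
  where
  open CommutativeSemiring S
  open IsSemiringHomomorphism h-hom

eval : ∀ {c ℓ} {G : Set} (R : RawSemiring c ℓ) → (G → RawSemiring.Carrier R) → Term G →
       RawSemiring.Carrier R
eval R ρ (gen g) = ρ g
eval R ρ θ       = RawSemiring.0# R
eval R ρ one     = RawSemiring.1# R
eval R ρ (s ∘ t) = RawSemiring._+_ R (eval R ρ s) (eval R ρ t)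
eval R ρ (s · t) = RawSemiring._*_ R (eval R ρ s) (eval R ρ t)

module _ {c ℓ} (T : CommutativeSemiring c ℓ) where

  open CommutativeSemiring T
  open Complements T using (+-idem)

  eval-sound : 1# + 1# ≈ 1# → ∀ {N} (ρ : Gen N → Carrier) →
               (∀ i → Complement T (ρ (inj₁ i)) (ρ (inj₂ i))) →
               ∀ {s t} → s ≈[ N ] t → eval rawSemiring ρ s ≈ eval rawSemiring ρ t
  eval-sound 1+1≈1 {N} ρ ρ-complement = sound
    where
    sound : ∀ {s t} → s ≈[ N ] t → eval rawSemiring ρ s ≈ eval rawSemiring ρ t
    sound ≈refl                = refl
    sound (≈sym e)             = sym (sound e)
    sound (≈trans e e')        = trans (sound e) (sound e')
    sound (∘-cong e e')        = +-cong (sound e) (sound e')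
    sound (·-cong e e')        = *-cong (sound e) (sound e')
    sound (∘-assoc _ _ _)      = +-assoc _ _ _
    sound (∘-comm _ _)         = +-comm _ _
    sound (∘-idˡ _)            = +-identityˡ _
    sound (∘-idʳ _)            = +-identityʳ _
    sound (·-assoc _ _ _)      = *-assoc _ _ _
    sound (·-comm _ _)         = *-comm _ _
    sound (·-idˡ _)            = *-identityˡ _
    sound (·-idʳ _)            = *-identityʳ _
    sound (·-distribˡ-∘ _ _ _) = distribˡ _ _ _
    sound (·-distribʳ-∘ _ _ _) = distribʳ _ _ _
    sound (·-zeroˡ _)          = zeroˡ _
    sound (·-zeroʳ _)          = zeroʳ _
    sound (compl-· i)          = proj₁ (ρ-complement i)
    sound (compl-∘ i)          = proj₂ (ρ-complement i)
    sound (idem-x i)           = +-idem 1+1≈1 _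
    sound (idem-xc i)          = +-idem 1+1≈1 _

ScX[_] : ℕ → CommutativeSemiring 0ℓ 0ℓ
ScX[ N ] = record
  { Carrier = Term (Gen N)
  ; _≈_ = λ s t → s ≈[ N ] t
  ; _+_ = _∘_
  ; _*_ = _·_
  ; 0# = θ
  ; 1# = one
  ; isCommutativeSemiring = isCommutativeSemiringˡ record
    { +-isCommutativeMonoid = isCommutativeMonoidˡ record
      { isSemigroup = record
        { isMagma = record { isEquivalence = ≈-isEquivalence ; ∙-cong = ∘-cong }
        ; assoc = ∘-assoc
        }
      ; identityˡ = ∘-idˡ
      ; comm = ∘-comm
      }
    ; *-isCommutativeMonoid = isCommutativeMonoidˡ record
      { isSemigroup = record
        { isMagma = record { isEquivalence = ≈-isEquivalence ; ∙-cong = ·-cong }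
        ; assoc = ·-assoc
        }
      ; identityˡ = ·-idˡ
      ; comm = ·-comm
      }
    ; distribʳ = ·-distribʳ-∘
    ; zeroˡ = ·-zeroˡ
    }
  }
  where
  ≈-isEquivalence : IsEquivalence (λ s t → s ≈[ N ] t)
  ≈-isEquivalence = record { refl = ≈refl ; sym = ≈sym ; trans = ≈trans }

ScX[_]-raw : ℕ → RawSemiring 0ℓ 0ℓ
ScX[ N ]-raw = CommutativeSemiring.rawSemiring ScX[ N ]

module _ {c ℓ} (T : CommutativeSemiring c ℓ) where

  open CommutativeSemiring T

  eval-unique : ∀ {N} {h : Term (Gen N) → Carrier} {w : Gen N → Carrier} →
                IsSemiringHomomorphism ScX[ N ]-raw rawSemiring h →
                (∀ g → h (gen g) ≈ w g) → ∀ a → h a ≈ eval rawSemiring w a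
  eval-unique {h = h} {w} h-hom h≈w = unique
    where
    open IsSemiringHomomorphism h-hom
    unique : ∀ a → h a ≈ eval rawSemiring w a
    unique (gen g) = h≈w g
    unique θ       = 0#-homo
    unique one     = 1#-homo
    unique (a ∘ b) = trans (+-homo a b) (+-cong (unique a) (unique b))
    unique (a · b) = trans (*-homo a b) (*-cong (unique a) (unique b))

module _ {n : ℕ} where
  open Complements ScX[ suc n ] hiding (Complement)

  one∘one≈one : (one ∘ one) ≈[ suc n ] one
  one∘one≈one =
    idempotent-complement⇒1+1≈1 (compl-· zero , compl-∘ zero) (idem-x zero) (idem-xc zero)

  term-complement : (a : Term (Gen (suc n))) → ∃ (Complement ScX[ suc n ] a)
  term-complement (gen (inj₁ i)) = gen (inj₂ i) , compl-· i , compl-∘ i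
  term-complement (gen (inj₂ i)) = gen (inj₁ i) , complement-comm (compl-· i , compl-∘ i)
  term-complement θ              = one , complement-0#-1#
  term-complement one            = θ , complement-comm complement-0#-1#
  term-complement (a ∘ b)        =
    zip _·_ (+-complement one∘one≈one) (term-complement a) (term-complement b)
  term-complement (a · b)        =
    zip _∘_ (*-complement one∘one≈one) (term-complement a) (term-complement b)

≡⇒≈ : ∀ {N} {s t : Term (Gen N)} → s ≡ t → s ≈[ N ] t
≡⇒≈ {N} = CommutativeSemiring.reflexive ScX[ N ]

lift-lift : ∀ {N M K} (p : N ≤ M) (q : M ≤ K) (r : N ≤ K) a → f[ q , f[ p , a ] ] ≡ f[ r , a ]
lift-lift p q r (gen (inj₁ i)) = cong (λ j → gen (inj₁ j)) (inject≤-idempotent i p q r)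
lift-lift p q r (gen (inj₂ i)) = cong (λ j → gen (inj₂ j)) (inject≤-idempotent i p q r)
lift-lift p q r θ              = ≡.refl
lift-lift p q r one            = ≡.refl
lift-lift p q r (a ∘ b)        = cong₂ _∘_ (lift-lift p q r a) (lift-lift p q r b)
lift-lift p q r (a · b)        = cong₂ _·_ (lift-lift p q r a) (lift-lift p q r b)

lift-cong : ∀ {N M} (p : N ≤ M) {s t} → s ≈[ N ] t → f[ p , s ] ≈[ M ] f[ p , t ]
lift-cong p ≈refl                 = ≈refl
lift-cong p (≈sym e)              = ≈sym (lift-cong p e)
lift-cong p (≈trans e e')         = ≈trans (lift-cong p e) (lift-cong p e')
lift-cong p (∘-cong e e')         = ∘-cong (lift-cong p e) (lift-cong p e')
lift-cong p (·-cong e e')         = ·-cong (lift-cong p e) (lift-cong p e')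
lift-cong p (∘-assoc _ _ _)       = ∘-assoc _ _ _
lift-cong p (∘-comm _ _)          = ∘-comm _ _
lift-cong p (∘-idˡ _)             = ∘-idˡ _
lift-cong p (∘-idʳ _)             = ∘-idʳ _
lift-cong p (·-assoc _ _ _)       = ·-assoc _ _ _
lift-cong p (·-comm _ _)          = ·-comm _ _
lift-cong p (·-idˡ _)             = ·-idˡ _
lift-cong p (·-idʳ _)             = ·-idʳ _
lift-cong p (·-distribˡ-∘ _ _ _)  = ·-distribˡ-∘ _ _ _
lift-cong p (·-distribʳ-∘ _ _ _)  = ·-distribʳ-∘ _ _ _
lift-cong p (·-zeroˡ _)           = ·-zeroˡ _
lift-cong p (·-zeroʳ _)           = ·-zeroʳ _
lift-cong p (compl-· i)           = compl-· _
lift-cong p (compl-∘ i)           = compl-∘ _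
lift-cong p (idem-x i)            = idem-x _
lift-cong p (idem-xc i)           = idem-xc _

~-refl : ∀ {x} → x ~ x
~-refl {i , a} = suc i , ≤-refl , ≤-refl , ≈refl

~-sym : ∀ {x y} → x ~ y → y ~ x
~-sym (k , p , q , e) = k , q , p , ≈sym e

~⇒≈-above : ∀ {i j a b K} (x~y : (i , a) ~ (j , b)) → proj₁ x~y ≤ K →
            (p : suc i ≤ K) (q : suc j ≤ K) → f[ p , a ] ≈[ K ] f[ q , b ]
~⇒≈-above {a = a} {b} (k , p₀ , q₀ , e) k≤K p q =
  ≈trans (≡⇒≈ (≡.sym (lift-lift p₀ k≤K p a)))
         (≈trans (lift-cong k≤K e) (≡⇒≈ (lift-lift q₀ k≤K q b)))

~-trans : ∀ {x y z} → x ~ y → y ~ z → x ~ z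
~-trans x~y@(k , p , q , _) y~z@(k' , p' , q' , _) =
  max k k' , ≤-trans p k≤ , ≤-trans q' k'≤ ,
  ≈trans (~⇒≈-above x~y k≤ _ (≤-trans q k≤)) (~⇒≈-above y~z k'≤ (≤-trans q k≤) _)
  where
  k≤ : k ≤ max k k'
  k≤ = m≤m⊔n k k'
  k'≤ : k' ≤ max k k'
  k'≤ = m≤n⊔m k k'

~-isEquivalence : IsEquivalence _~_
~-isEquivalence = record { refl = ~-refl ; sym = ~-sym ; trans = ~-trans }

ι : ∀ k → Term (Gen (suc k)) → ScX
ι k a = k , a

ι-cong : ∀ {k a b} → a ≈[ suc k ] b → ι k a ~ ι k b
ι-cong {k} e = suc k , ≤-refl , ≤-refl , lift-cong ≤-refl e

~-lift : ∀ x {k} (p : suc (proj₁ x) ≤ suc k) → x ~ ι k f[ p , proj₂ x ]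
~-lift (i , a) {k} p = suc k , p , ≤-refl , ≡⇒≈ (≡.sym (lift-lift p ≤-refl p a))

-- Defs' _∘L_ and _·L_ are definitionally the operations _⊕L_ below for _∘_ and _·_.
module Levelwise (_⊕_ : ∀ {N} → Term (Gen N) → Term (Gen N) → Term (Gen N))
                 (⊕-cong : ∀ {N} {s s' t t' : Term (Gen N)} →
                           s ≈[ N ] s' → t ≈[ N ] t' → (s ⊕ t) ≈[ N ] (s' ⊕ t'))
                 (lift-⊕ : ∀ {N M} (p : N ≤ M) s t → f[ p , s ⊕ t ] ≡ f[ p , s ] ⊕ f[ p , t ])
                 where

  _⊕L_ : ScX → ScX → ScX
  (i , a) ⊕L (j , b) = max i j , f[ s≤s (m≤m⊔n i j) , a ] ⊕ f[ s≤s (m≤n⊔m i j) , b ]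

  lift-⊕L : ∀ {i j a b K} (r : suc (max i j) ≤ K) (p : suc i ≤ K) (q : suc j ≤ K) →
            f[ r , proj₂ ((i , a) ⊕L (j , b)) ] ≡ f[ p , a ] ⊕ f[ q , b ]
  lift-⊕L {i} {j} {a} {b} r p q =
    ≡.trans (lift-⊕ r _ _) (cong₂ _⊕_ (lift-lift _ r p a) (lift-lift _ r q b))

  ⊕L-cong : ∀ {x x' y y'} → x ~ x' → y ~ y' → (x ⊕L y) ~ (x' ⊕L y')
  ⊕L-cong {i , _} {i' , _} {j , _} {j' , _} x~x'@(k , p , q , _) y~y'@(k' , p' , q' , _) =
    max k k' , ⊔-mono-≤ p p' , ⊔-mono-≤ q q' ,
    ≈trans (≡⇒≈ (lift-⊕L _ px py))
      (≈trans (⊕-cong (~⇒≈-above x~x' k≤ px qx) (~⇒≈-above y~y' k'≤ py qy))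
              (≡⇒≈ (≡.sym (lift-⊕L _ qx qy))))
    where
    k≤ : k ≤ max k k'
    k≤ = m≤m⊔n k k'
    k'≤ : k' ≤ max k k'
    k'≤ = m≤n⊔m k k'
    px : suc i ≤ max k k'
    px = ≤-trans p k≤
    qx : suc i' ≤ max k k'
    qx = ≤-trans q k≤
    py : suc j ≤ max k k'
    py = ≤-trans p' k'≤
    qy : suc j' ≤ max k k'
    qy = ≤-trans q' k'≤

  ι-⊕ : ∀ {k a b} → ι k (a ⊕ b) ~ (ι k a ⊕L ι k b)
  ι-⊕ {k} {a} {b} =
    suc (max k k) , k≤ , ≤-refl ,
    ≡⇒≈ (≡.trans (lift-⊕ k≤ a b) (≡.sym (lift-⊕L ≤-refl k≤ k≤)))
    where
    k≤ : suc k ≤ suc (max k k)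
    k≤ = s≤s (m≤m⊔n k k)

module ∘L = Levelwise (λ s t → s ∘ t) ∘-cong (λ _ _ _ → ≡.refl)
module ·L = Levelwise (λ s t → s · t) ·-cong (λ _ _ _ → ≡.refl)

ι-hom : ∀ k → IsSemiringHomomorphism ScX[ suc k ]-raw ScX-raw (ι k)
ι-hom k = record
  { isNearSemiringHomomorphism = record
    { +-isMonoidHomomorphism = record
      { isMagmaHomomorphism = record
        { isRelHomomorphism = record { cong = ι-cong }
        ; homo = λ _ _ → ∘L.ι-⊕
        }
      ; ε-homo = suc k , ≤-refl , s≤s z≤n , ≈refl
      }
    ; *-homo = λ _ _ → ·L.ι-⊕
    }
  ; 1#-homo = suc k , ≤-refl , s≤s z≤n , ≈refl
  }

common-level : ∀ {n} (ρ : Fin n → ScX) →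
               ∃₂ λ k (σ : Fin n → Term (Gen (suc k))) → ∀ v → ρ v ~ ι k (σ v)
common-level {zero}  ρ = 0 , (λ ()) , (λ ())
common-level {suc n} ρ with common-level (λ v → ρ (suc v))
... | k , σ , ρ~σ = max i k , σ' , ρ~σ'
  where
  i : ℕ
  i = proj₁ (ρ zero)
  σ' : Fin (suc n) → Term (Gen (suc (max i k)))
  σ' zero    = f[ s≤s (m≤m⊔n i k) , proj₂ (ρ zero) ]
  σ' (suc v) = f[ s≤s (m≤n⊔m i k) , σ v ]
  ρ~σ' : ∀ v → ρ v ~ ι (max i k) (σ' v)
  ρ~σ' zero    = ~-lift (ρ zero) _
  ρ~σ' (suc v) = ~-trans (ρ~σ v) (~-lift (ι k (σ v)) _)

eval-ι : ∀ {V : Set} {k} {ρ : V → ScX} {σ : V → Term (Gen (suc k))} →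
         (∀ v → ρ v ~ ι k (σ v)) →
         ∀ e → eval ScX-raw ρ e ~ ι k (eval ScX[ suc k ]-raw σ e)
eval-ι         ρ~σ (gen v)  = ρ~σ v
eval-ι {k = k} ρ~σ θ        = ~-sym (IsSemiringHomomorphism.0#-homo (ι-hom k))
eval-ι {k = k} ρ~σ one      = ~-sym (IsSemiringHomomorphism.1#-homo (ι-hom k))
eval-ι         ρ~σ (e ∘ e') =
  ~-trans (∘L.⊕L-cong (eval-ι ρ~σ e) (eval-ι ρ~σ e')) (~-sym ∘L.ι-⊕)
eval-ι         ρ~σ (e · e') =
  ~-trans (·L.⊕L-cong (eval-ι ρ~σ e) (eval-ι ρ~σ e')) (~-sym ·L.ι-⊕)

levelwise-identity : ∀ {n} (e e' : Term (Fin n)) →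
  (∀ {N} (σ : Fin n → Term (Gen N)) →
     eval ScX[ N ]-raw σ e ≈[ N ] eval ScX[ N ]-raw σ e') →
  ∀ (ρ : Fin n → ScX) → eval ScX-raw ρ e ~ eval ScX-raw ρ e'
levelwise-identity e e' holds ρ =
  let (k , σ , ρ~σ) = common-level ρ in
  ~-trans (eval-ι ρ~σ e) (~-trans (ι-cong (holds σ)) (~-sym (eval-ι ρ~σ e')))

ScX-commutativeSemiring : CommutativeSemiring 0ℓ 0ℓ
ScX-commutativeSemiring = record
  { Carrier = ScX
  ; _≈_ = _~_
  ; _+_ = _∘L_
  ; _*_ = _·L_
  ; 0# = θL
  ; 1# = 1L
  ; isCommutativeSemiring = isCommutativeSemiringˡ record
    { +-isCommutativeMonoid = isCommutativeMonoidˡ record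
      { isSemigroup = record
        { isMagma = record { isEquivalence = ~-isEquivalence ; ∙-cong = ∘L.⊕L-cong }
        ; assoc = λ x y z → levelwise-identity ((x₀ ∘ x₁) ∘ x₂) (x₀ ∘ (x₁ ∘ x₂))
                              (λ _ → ∘-assoc _ _ _) (x ∷ y ∷ z ∷ [])
        }
      ; identityˡ = λ x → levelwise-identity (θ ∘ x₀) x₀ (λ _ → ∘-idˡ _) (x ∷ [])
      ; comm = λ x y → levelwise-identity (x₀ ∘ x₁) (x₁ ∘ x₀) (λ _ → ∘-comm _ _) (x ∷ y ∷ [])
      }
    ; *-isCommutativeMonoid = isCommutativeMonoidˡ record
      { isSemigroup = record
        { isMagma = record { isEquivalence = ~-isEquivalence ; ∙-cong = ·L.⊕L-cong }
        ; assoc = λ x y z → levelwise-identity ((x₀ · x₁) · x₂) (x₀ · (x₁ · x₂))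
                              (λ _ → ·-assoc _ _ _) (x ∷ y ∷ z ∷ [])
        }
      ; identityˡ = λ x → levelwise-identity (one · x₀) x₀ (λ _ → ·-idˡ _) (x ∷ [])
      ; comm = λ x y → levelwise-identity (x₀ · x₁) (x₁ · x₀) (λ _ → ·-comm _ _) (x ∷ y ∷ [])
      }
    ; distribʳ = λ x y z → levelwise-identity ((x₁ ∘ x₂) · x₀) ((x₁ · x₀) ∘ (x₂ · x₀))
                             (λ _ → ·-distribʳ-∘ _ _ _) (x ∷ y ∷ z ∷ [])
    ; zeroˡ = λ x → levelwise-identity (θ · x₀) θ (λ _ → ·-zeroˡ _) (x ∷ [])
    }
  }
  where
  x₀ : ∀ {n} → Term (Fin (suc n))
  x₀ = gen zero
  x₁ : ∀ {n} → Term (Fin (suc (suc n)))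
  x₁ = gen (suc zero)
  x₂ : ∀ {n} → Term (Fin (suc (suc (suc n))))
  x₂ = gen (suc (suc zero))

toXXc : ∀ {N} → Gen N → XXc
toXXc = ⊎-map toℕ toℕ

eval-lift : ∀ {c ℓ} (R : RawSemiring c ℓ) (w : XXc → RawSemiring.Carrier R)
            {N M} (p : N ≤ M) a →
            eval R (λ g → w (toXXc g)) f[ p , a ] ≡ eval R (λ g → w (toXXc g)) a
eval-lift R w p (gen (inj₁ i)) = cong (λ m → w (inj₁ m)) (toℕ-inject≤ i p)
eval-lift R w p (gen (inj₂ i)) = cong (λ m → w (inj₂ m)) (toℕ-inject≤ i p)
eval-lift R w p θ              = ≡.refl
eval-lift R w p one            = ≡.refl
eval-lift R w p (a ∘ b)        = cong₂ (RawSemiring._+_ R) (eval-lift R w p a) (eval-lift R w p b)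
eval-lift R w p (a · b)        = cong₂ (RawSemiring._*_ R) (eval-lift R w p a) (eval-lift R w p b)

inject≤-fromℕ-toℕ : ∀ {n} (i : Fin (suc n)) →
                    inject≤ i ≤-refl ≡ inject≤ (fromℕ (toℕ i)) (toℕ<n i)
inject≤-fromℕ-toℕ i = toℕ-injective
  (≡.trans (toℕ-inject≤ i _) (≡.trans (≡.sym (toℕ-fromℕ _)) (≡.sym (toℕ-inject≤ _ _))))

ι-gen~η : ∀ {n} (g : Gen (suc n)) → ι n (gen g) ~ η (toXXc g)
ι-gen~η {n} (inj₁ i) =
  suc n , ≤-refl , toℕ<n i , ≡⇒≈ (cong (λ j → gen (inj₁ j)) (inject≤-fromℕ-toℕ i))
ι-gen~η {n} (inj₂ i) =
  suc n , ≤-refl , toℕ<n i , ≡⇒≈ (cong (λ j → gen (inj₂ j)) (inject≤-fromℕ-toℕ i))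

module _ {c ℓ} (T : ICSemiring c ℓ) where

  open ICSemiring T

  module UniversalProperty (f : XXc → Carrier)
                           (f·≈0 : ∀ i → (f (inj₁ i) * f (inj₂ i)) ≈ 0#)
                           (f+≈1 : ∀ i → (f (inj₁ i) + f (inj₂ i)) ≈ 1#) where

    fbar : ScX → Carrier
    fbar (n , a) = eval rawSemiring (λ g → f (toXXc g)) a

    fbar-cong : ∀ {x y} → x ~ y → fbar x ≈ fbar y
    fbar-cong {i , a} {j , b} (k , p , q , e) =
      trans (reflexive (≡.sym (eval-lift rawSemiring f p a)))
            (trans (eval-sound commutativeSemiring 1+1≈1 (λ g → f (toXXc g))
                               (λ i → f·≈0 (toℕ i) , f+≈1 (toℕ i)) e)
                   (reflexive (eval-lift rawSemiring f q b)))
      where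
      1+1≈1 : 1# + 1# ≈ 1#
      1+1≈1 = proj₂ (proj₂ (proj₂ (proj₂ (complement 1#))))

    fbar-hom : IsSemiringHomomorphism ScX-raw rawSemiring fbar
    fbar-hom = record
      { isNearSemiringHomomorphism = record
        { +-isMonoidHomomorphism = record
          { isMagmaHomomorphism = record
            { isRelHomomorphism = record { cong = fbar-cong }
            ; homo = fbar-∘L
            }
          ; ε-homo = refl
          }
        ; *-homo = fbar-·L
        }
      ; 1#-homo = refl
      }
      where
      fbar-∘L : ∀ x y → fbar (x ∘L y) ≈ fbar x + fbar y
      fbar-∘L (i , a) (j , b) =
        reflexive (cong₂ _+_ (eval-lift rawSemiring f _ a) (eval-lift rawSemiring f _ b))
      fbar-·L : ∀ x y → fbar (x ·L y) ≈ fbar x * fbar y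
      fbar-·L (i , a) (j , b) =
        reflexive (cong₂ _*_ (eval-lift rawSemiring f _ a) (eval-lift rawSemiring f _ b))

    fbar-η : ∀ x → fbar (η x) ≈ f x
    fbar-η (inj₁ i) = reflexive (cong (λ m → f (inj₁ m)) (toℕ-fromℕ i))
    fbar-η (inj₂ i) = reflexive (cong (λ m → f (inj₂ m)) (toℕ-fromℕ i))

    fbar-unique : ∀ g → IsSemiringHomomorphism ScX-raw rawSemiring g → (∀ x → g (η x) ≈ f x) →
                  ∀ s → g s ≈ fbar s
    fbar-unique g g-hom g∘η≈f (n , a) =
      eval-unique commutativeSemiring (Composition.isSemiringHomomorphism trans (ι-hom n) g-hom)
        (λ m → trans (IsSemiringHomomorphism.⟦⟧-cong g-hom (ι-gen~η m)) (g∘η≈f (toXXc m))) a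

Bool-ICSemiring : ICSemiring 0ℓ 0ℓ
Bool-ICSemiring = record
  { commutativeSemiring = ∨-∧-commutativeSemiring
  ; 1≉0 = λ ()
  ; complement = λ b → not b , ∧-inverseʳ b , ∨-inverseʳ b , ∧-idem b , ∨-idem b
  }

literal : (ℕ → Bool) → XXc → Bool
literal σ (inj₁ i) = σ i
literal σ (inj₂ i) = not (σ i)

module Literal (σ : ℕ → Bool) =
  UniversalProperty Bool-ICSemiring (literal σ) (λ i → ∧-inverseʳ (σ i)) (λ i → ∨-inverseʳ (σ i))

η-~⇒literal-≡ : ∀ σ {x y} → η x ~ η y → literal σ x ≡ literal σ y
η-~⇒literal-≡ σ {x} {y} ηx~ηy =
  ≡.trans (≡.sym (fbar-η x)) (≡.trans (fbar-cong ηx~ηy) (fbar-η y))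
  where open Literal σ

≡ᵇ-indicator⇒≡ : ∀ {i j} → (i ≡ᵇ i) ≡ (j ≡ᵇ i) → i ≡ j
≡ᵇ-indicator⇒≡ {i} {j} eq = ≡.sym (≡ᵇ⇒≡ j i (≡.subst T eq (≡⇒≡ᵇ i i ≡.refl)))

literals-separate : ∀ {x y} → (∀ σ → literal σ x ≡ literal σ y) → x ≡ y
literals-separate {inj₁ i} {inj₁ j} same = cong inj₁ (≡ᵇ-indicator⇒≡ (same (_≡ᵇ i)))
literals-separate {inj₂ i} {inj₂ j} same =
  cong inj₂ (≡ᵇ-indicator⇒≡ (not-injective (same (_≡ᵇ i))))
literals-separate {inj₁ i} {inj₂ j} same with same (λ _ → true)
... | ()
literals-separate {inj₂ i} {inj₁ j} same with same (λ _ → true)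
... | ()

η-injective : ∀ x y → η x ~ η y → x ≡ y
η-injective x y ηx~ηy = literals-separate (λ σ → η-~⇒literal-≡ σ {x} {y} ηx~ηy)

1L≁θL : ¬ (1L ~ θL)
1L≁θL 1~θ with Literal.fbar-cong (λ _ → true) 1~θ
... | ()

ScX-isICSemiring : IsICSemiring _~_ _∘L_ _·L_ θL 1L
ScX-isICSemiring = isICSemiring (ι-cong one∘one≈one) 1L≁θL complemented
  where
  open Complements ScX-commutativeSemiring using (isICSemiring)
  complemented : ∀ x → ∃ (Complement ScX-commutativeSemiring x)
  complemented (n , a) =
    let (a' , a-a') = term-complement a in
    ι n a' , complement-homo {R = ScX[ suc n ]} {S = ScX-commutativeSemiring} (ι-hom n) a-a'

proposition3p3 :
    (c ℓ : Level) →
    IsICSemiring _~_ _∘L_ _·L_ θL 1L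
    × (∀ x y → η x ~ η y → x ≡ y)
    × ((T : ICSemiring c ℓ) → let open ICSemiring T in
        (f : XXc → Carrier) →
        (∀ i → (f (inj₁ i) * f (inj₂ i)) ≈ 0#) →
        (∀ i → (f (inj₁ i) + f (inj₂ i)) ≈ 1#) →
        Σ (ScX → Carrier) λ fbar →
          SemiringMorphisms.IsSemiringHomomorphism ScX-raw rawSemiring fbar
          × (∀ x → fbar (η x) ≈ f x)
          × (∀ (g : ScX → Carrier) →
               SemiringMorphisms.IsSemiringHomomorphism ScX-raw rawSemiring g →
               (∀ x → g (η x) ≈ f x) →
               ∀ s → g s ≈ fbar s))
proposition3p3 c ℓ = ScX-isICSemiring , η-injective , λ T f f·≈0 f+≈1 →
  let open UniversalProperty T f f·≈0 f+≈1 in fbar , fbar-hom , fbar-η , fbar-unique
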